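{- Let $S$ be a finite left regular band with identity, $L$ its support lattice, $k$ a field, and $Y\in L$. Let $S_{\le Y}=\{w\in S:\operatorname{supp}(w)\le Y\}$ and let $\operatorname{proj}:kS\to kS_{\le Y}$ be the linear projection onto the span of $S_{\le Y}$ along the span of $S\setminus S_{\le Y}$. Let $\{e_X:X\in L\}$ be a complete system of primitive orthogonal idempotents of $kS$, indexed so that $\chi_X(e_X)=1$ for each $X$. Then $\{\operatorname{proj}(e_X):X\le Y\}$ is a complete system of primitive orthogonal idempotents of the semigroup algebra $k(S_{\le Y})$, and $k(S_{\le Y})$ is isomorphic to $kS\left(\sum_{X\le Y}e_X\right)$.
   Context: A left regular band is a semigroup $S$ with $x^2=x$ and $xyx=xy$ for all $x,y\in S$. Define the preorder $u\preceq v$ iff $vu=v$; identifying $u,v$ when $u\preceq v\preceq u$ gives the support lattice $L$ with quotient map $\operatorname{supp}:S\to L$, satisfying $\operatorname{supp}(uv)=\operatorname{supp}(u)\vee\operatorname{supp}(v)$ and $uv=u$ iff $\operatorname{supp}(v)\le\operatorname{supp}(u)$. $\chi_X:kS\to k$ is the linear extension of $\chi_X(s)=1$ if $\operatorname{supp}(s)\le X$ and $0$ otherwise. A complete system of primitive orthogonal idempotents is a family of pairwise orthogonal primitive idempotents summing to the identity. -}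

module Defs where

open import Level using (Level; _⊔_; suc)
open import Data.Nat using (ℕ)
open import Data.Fin using (Fin; _≟_)
open import Data.Fin.Properties using (all?)
open import Data.Bool using (Bool; if_then_else_)
open import Data.Product using (Σ; ∃; _×_; _,_)
open import Data.Empty using (⊥)
open import Data.Unit.Polymorphic using (⊤)
open import Relation.Nullary using (¬_; Dec; does; yes; no)
open import Relation.Nullary.Decidable using (_→-dec_)
open import Relation.Binary.PropositionalEquality using (_≡_; _≢_)
open import Function using (_⇔_)
open import Algebra.Bundles using (CommutativeRing)
import Algebra.Properties.Monoid.Sum as MonoidSum

record Field (c ℓ : Level) : Set (Level.suc (c ⊔ ℓ)) where
  field
    commutativeRing : CommutativeRing c ℓ
  open CommutativeRing commutativeRing public
  field
    0≉1     : ¬ (0# ≈ 1#)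
    inverse : ∀ x → ¬ (x ≈ 0#) → ∃ λ y → x * y ≈ 1#

record LRB (n : ℕ) : Set where
  infixl 7 _·_
  field
    _·_       : Fin n → Fin n → Fin n
    assoc     : ∀ x y z → (x · y) · z ≡ x · (y · z)
    idem      : ∀ x → x · x ≡ x
    leftReg   : ∀ x y → x · y · x ≡ x · y
    one       : Fin n
    identityˡ : ∀ x → one · x ≡ x
    identityʳ : ∀ x → x · one ≡ x

  _⪯_ : Fin n → Fin n → Set
  u ⪯ v = v · u ≡ v

-- Since Agda (without cubical) has no
-- quotient types, L is characterised as the quotient of S by the
-- equivalence  u ⪯ v ⪯ u :  supp is surjective and identifies exactly
-- the ⪯-equivalent elements.

record Support {n : ℕ} (S : LRB n) (m : ℕ) : Set where
  open LRB S
  field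
    supp      : Fin n → Fin m
    surjective : ∀ X → ∃ λ s → supp s ≡ X
    kernel    : ∀ u v → (supp u ≡ supp v) ⇔ (u ⪯ v × v ⪯ u)

  _≤L_ : Fin m → Fin m → Set
  X ≤L Y = ∀ u v → supp u ≡ X → supp v ≡ Y → u ⪯ v

  _≤L?_ : ∀ X Y → Dec (X ≤L Y)
  X ≤L? Y = all? λ u → all? λ v →
              (supp u ≟ X) →-dec ((supp v ≟ Y) →-dec (v · u ≟ v))

module SemigroupAlgebra {c ℓ : Level} (F : Field c ℓ) {n : ℕ} (S : LRB n)
               {m : ℕ} (Sp : Support S m) where

  open Field F
  open LRB S
  open Support Sp
  open MonoidSum +-monoid using (sum)

  KS : Set c
  KS = Fin n → Carrier

  infix 4 _≈ₛ_
  _≈ₛ_ : KS → KS → Set ℓ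
  f ≈ₛ g = ∀ s → f s ≈ g s

  zeroₛ : KS
  zeroₛ _ = 0#

  δ : Fin n → KS
  δ s t = if does (s ≟ t) then 1# else 0#

  -- identity of kS (= identity of k(S≤Y), since 1 ∈ S≤Y)
  oneₛ : KS
  oneₛ = δ one

  infixl 6 _+ₛ_
  _+ₛ_ : KS → KS → KS
  (f +ₛ g) s = f s + g s

  infixl 7 _⋆_ _•_
  _⋆_ : Carrier → KS → KS
  (a ⋆ f) s = a * f s

  _•_ : KS → KS → KS
  (f • g) t = sum λ u → sum λ v →
                if does (u · v ≟ t) then f u * g v else 0#

  sumOver : ∀ {p} {P : Fin p → Set} → (∀ i → Dec (P i)) → (Fin p → KS) → KS
  sumOver P? f s = sum λ i → if does (P? i) then f i s else 0#

  χ : Fin m → KS → Carrier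
  χ X f = sum λ s → if does (supp s ≤L? X) then f s else 0#

  InSub : Fin m → KS → Set ℓ
  InSub Y f = ∀ s → ¬ (supp s ≤L Y) → f s ≈ 0#

  proj : Fin m → KS → KS
  proj Y f s = if does (supp s ≤L? Y) then f s else 0#

  -- Idempotents, orthogonality, primitivity inside a subalgebra A
  -- (given as a predicate on kS; A = λ _ → ⊤ for kS itself)
  IsIdempotent : KS → Set ℓ
  IsIdempotent e = e • e ≈ₛ e

  Orthogonal : KS → KS → Set ℓ
  Orthogonal a b = (a • b ≈ₛ zeroₛ) × (b • a ≈ₛ zeroₛ)

  IsPrimitiveIn : ∀ {a} → (KS → Set a) → KS → Set (c ⊔ ℓ ⊔ a)
  IsPrimitiveIn A e =
    A e × IsIdempotent e × ¬ (e ≈ₛ zeroₛ) ×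
    (∀ x y → A x → A y → IsIdempotent x → IsIdempotent y →
       Orthogonal x y → e ≈ₛ x +ₛ y → ¬ (x ≈ₛ zeroₛ) → ¬ (y ≈ₛ zeroₛ) → ⊥)

  IsCompleteSystem : ∀ {a p} {P : Fin p → Set} → (KS → Set a) →
                     (∀ i → Dec (P i)) → (Fin p → KS) → Set (c ⊔ ℓ ⊔ a)
  IsCompleteSystem {P = P} A P? f =
    (∀ i → P i → IsPrimitiveIn A (f i)) ×
    (∀ i j → P i → P j → i ≢ j → f i • f j ≈ₛ zeroₛ) ×
    (sumOver P? f ≈ₛ oneₛ)

  Whole : KS → Set ℓ
  Whole _ = ⊤

  everyIndex : ∀ {p} (i : Fin p) → Dec (⊤ {Level.zero})
  everyIndex _ = yes _

  InLeftIdeal : KS → KS → Set (c ⊔ ℓ)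
  InLeftIdeal ε x = ∃ λ a → x ≈ₛ a • ε

  IsAlgIsoOnto : Fin m → KS → (KS → KS) → Set (c ⊔ ℓ)
  IsAlgIsoOnto Y ε φ =
    (∀ f g → InSub Y f → InSub Y g → f ≈ₛ g → φ f ≈ₛ φ g) ×
    (∀ f g → InSub Y f → InSub Y g → φ (f +ₛ g) ≈ₛ φ f +ₛ φ g) ×
    (∀ a f → InSub Y f → φ (a ⋆ f) ≈ₛ a ⋆ φ f) ×
    (∀ f g → InSub Y f → InSub Y g → φ (f • g) ≈ₛ φ f • φ g) ×
    (∀ f → InSub Y f → InLeftIdeal ε (φ f)) ×
    (∀ f g → InSub Y f → InSub Y g → φ f ≈ₛ φ g → f ≈ₛ g) ×
    (∀ x → InLeftIdeal ε x → ∃ λ f → InSub Y f × φ f ≈ₛ x)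

-- The characters χ_X are algebra maps kS → k, and proj_Y is an algebra
-- endomorphism of kS because uv ∈ S≤Y iff u, v ∈ S≤Y.  The engine of the
-- proof is a vanishing criterion: an idempotent a is zero as soon as, at
-- every s, either a(s) = 0 or χ_{supp s}(a) = 0.  Indeed, if a vanishes
-- strictly below supp s, then g = proj_{supp s}(a) is idempotent and the
-- only products uv = s contributing to (gg)(s) have supp u = supp s, hence
-- uv = u; so g(s) = g(s) χ_{supp s}(a), and one inducts on the support
-- lattice.
--
-- The criterion kills proj_Y(e_X) for X ≰ Y, and it kills any summand of a
-- decomposition of proj_Y(e_X), X ≤ Y, into orthogonal idempotents of
-- k(S≤Y) that is annihilated by χ_X; this gives the complete system.  It
-- also kills s·e_X whenever supp s ≰ X, since then every character
-- vanishes on it.  So right multiplication by ε = Σ_{X≤Y} e_X factors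
-- through proj_Y, and as proj_Y(ε) = 1, f ↦ fε is an isomorphism
-- k(S≤Y) → kS·ε with inverse proj_Y.

module Submission where

open import Defs
open import Level using (Level)
open import Data.Nat using (ℕ; suc)
open import Data.Fin using (Fin; _≟_; punchIn)
open import Data.Fin.Properties using (punchInᵢ≢i)
open import Data.Fin.Induction using (po-wellFounded)
open import Data.Bool using (true; false; if_then_else_)
open import Data.Product using (∃; _×_; _,_; proj₁; proj₂)
open import Data.Sum using (_⊎_; inj₁; inj₂)
open import Data.Empty using (⊥)
open import Function using (id; _∘_; Equivalence)
open import Relation.Nullary using (¬_; Dec; does; yes; no; contradiction)
open import Relation.Binary using (Rel; IsPartialOrder)
open import Relation.Binary.PropositionalEquality as ≡ using (_≡_; _≢_; _≗_)
import Relation.Binary.Construct.NonStrictToStrict as ToStrict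
import Relation.Binary.Construct.On as On
open import Induction.WellFounded using (WellFounded; module All)
open import Algebra.Bundles using (Semiring)
import Algebra.Properties.Semiring.Sum as SemiringSum
import Relation.Binary.Reasoning.Setoid as SetoidReasoning

module _ {c ℓ : Level} (R : Semiring c ℓ) where
  open Semiring R

  idempotent≈0 : ∀ {x y} → x * x ≈ x → x * y ≈ 0# → x + y ≈ 0# → x ≈ 0#
  idempotent≈0 {x} {y} xx≈x xy≈0 x+y≈0 = begin
    x             ≈⟨ sym xx≈x ⟩
    x * x         ≈⟨ sym (+-identityʳ _) ⟩
    x * x + 0#    ≈⟨ +-congˡ (sym xy≈0) ⟩
    x * x + x * y ≈⟨ sym (distribˡ x x y) ⟩
    x * (x + y)   ≈⟨ *-congˡ x+y≈0 ⟩
    x * 0#        ≈⟨ zeroʳ x ⟩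
    0#            ∎
    where open SetoidReasoning setoid

module _ {c ℓ : Level} (F : Field c ℓ) where
  open Field F

  x≉0⇒x*y≈0⇒y≈0 : ∀ {x y} → ¬ (x ≈ 0#) → x * y ≈ 0# → y ≈ 0#
  x≉0⇒x*y≈0⇒y≈0 {x} {y} x≉0 xy≈0 with x′ , xx′≈1 ← inverse x x≉0 = begin
    y            ≈⟨ sym (*-identityˡ y) ⟩
    1# * y       ≈⟨ *-congʳ (sym (trans (*-comm x′ x) xx′≈1)) ⟩
    (x′ * x) * y ≈⟨ *-assoc x′ x y ⟩
    x′ * (x * y) ≈⟨ *-congˡ xy≈0 ⟩
    x′ * 0#      ≈⟨ zeroʳ x′ ⟩
    0#           ∎
    where open SetoidReasoning setoid

module ConditionalSums {c ℓ : Level} (R : Semiring c ℓ) where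
  open Semiring R
  open SemiringSum R
    using (sum; sum-cong-≋; sum-remove; sum-replicate-zero; ∑-comm; *-distribˡ-sum; *-distribʳ-sum)
  open SetoidReasoning setoid

  if-yes : ∀ {A : Set} (d : Dec A) {x} → A → (if does d then x else 0#) ≈ x
  if-yes (yes _) a = refl
  if-yes (no ¬a) a = contradiction a ¬a

  if-no : ∀ {A : Set} (d : Dec A) {x} → ¬ A → (if does d then x else 0#) ≈ 0#
  if-no (yes a) ¬a = contradiction a ¬a
  if-no (no _) ¬a = refl

  if-≈0 : ∀ b {x} → x ≈ 0# → (if b then x else 0#) ≈ 0#
  if-≈0 true x≈0 = x≈0
  if-≈0 false x≈0 = refl

  if-cong : ∀ b {x y} → x ≈ y → (if b then x else 0#) ≈ (if b then y else 0#)
  if-cong true x≈y = x≈y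
  if-cong false x≈y = refl

  if-+ : ∀ b x y → (if b then x + y else 0#) ≈ (if b then x else 0#) + (if b then y else 0#)
  if-+ true x y = refl
  if-+ false x y = sym (+-identityˡ 0#)

  if-* : ∀ b x y → (if b then x else 0#) * y ≈ (if b then x * y else 0#)
  if-* true x y = refl
  if-* false x y = zeroˡ y

  *-if : ∀ b x y → x * (if b then y else 0#) ≈ (if b then x * y else 0#)
  *-if true x y = refl
  *-if false x y = zeroʳ x

  if-if-comm : ∀ b b′ x →
               (if b then (if b′ then x else 0#) else 0#) ≈ (if b′ then (if b then x else 0#) else 0#)
  if-if-comm true b′ x = refl
  if-if-comm false true x = refl
  if-if-comm false false x = refl

  sum-≈0 : ∀ {k} {f : Fin k → Carrier} → (∀ i → f i ≈ 0#) → sum f ≈ 0#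
  sum-≈0 {k} f≈0 = trans (sum-cong-≋ f≈0) (sum-replicate-zero k)

  if-sum : ∀ {k} b (f : Fin k → Carrier) → (if b then sum f else 0#) ≈ sum (λ i → if b then f i else 0#)
  if-sum true f = refl
  if-sum {k} false f = sym (sum-≈0 {k} λ _ → refl)

  sum-single : ∀ {k} (j : Fin k) {f : Fin k → Carrier} → (∀ i → i ≢ j → f i ≈ 0#) → sum f ≈ f j
  sum-single {suc k} j {f} f≈0 = begin
    sum f                     ≈⟨ sum-remove f ⟩
    f j + sum (f ∘ punchIn j) ≈⟨ +-congˡ (sum-≈0 λ i → f≈0 (punchIn j i) (punchInᵢ≢i j i)) ⟩
    f j + 0#                  ≈⟨ +-identityʳ (f j) ⟩
    f j                       ∎

  sum-δ : ∀ {k} (j : Fin k) (f : Fin k → Carrier) → sum (λ i → if does (j ≟ i) then f i else 0#) ≈ f j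
  sum-δ j f = trans (sum-single j λ i i≢j → if-no (j ≟ i) (i≢j ∘ ≡.sym)) (if-yes (j ≟ j) ≡.refl)

  sum-δ′ : ∀ {k} (j : Fin k) (f : Fin k → Carrier) → sum (λ i → if does (i ≟ j) then f i else 0#) ≈ f j
  sum-δ′ j f = trans (sum-single j λ i i≢j → if-no (i ≟ j) i≢j) (if-yes (j ≟ j) ≡.refl)

  sum-*-swap : ∀ {k l} (f : Fin k → Carrier) (g : Fin k → Fin l → Carrier) (h : Fin l → Carrier) →
               sum (λ w → sum (λ u → f u * g u w) * h w) ≈ sum (λ u → f u * sum (λ w → g u w * h w))
  sum-*-swap f g h = begin
    sum (λ w → sum (λ u → f u * g u w) * h w)
      ≈⟨ sum-cong-≋ (λ w → *-distribʳ-sum (h w) (λ u → f u * g u w)) ⟩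
    sum (λ w → sum λ u → (f u * g u w) * h w)
      ≈⟨ ∑-comm (λ w u → (f u * g u w) * h w) ⟩
    sum (λ u → sum λ w → (f u * g u w) * h w)
      ≈⟨ sum-cong-≋ (λ u → sum-cong-≋ λ w → *-assoc (f u) (g u w) (h w)) ⟩
    sum (λ u → sum λ w → f u * (g u w * h w))
      ≈⟨ sum-cong-≋ (λ u → sym (*-distribˡ-sum (f u) (λ w → g u w * h w))) ⟩
    sum (λ u → f u * sum (λ w → g u w * h w)) ∎

  push : ∀ {k l} → (Fin k → Fin l) → (Fin k → Carrier) → Fin l → Carrier
  push p g t = sum λ v → if does (p v ≟ t) then g v else 0#

  push-cong : ∀ {k l} (p : Fin k → Fin l) {g g′} t → (∀ v → g v ≈ g′ v) → push p g t ≈ push p g′ t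
  push-cong p t g≈g′ = sum-cong-≋ λ v → if-cong (does (p v ≟ t)) (g≈g′ v)

  push-congˡ : ∀ {k l} {p q : Fin k → Fin l} g t → p ≗ q → push p g t ≈ push q g t
  push-congˡ g t p≗q =
    sum-cong-≋ λ v → reflexive (≡.cong (λ w → if does (w ≟ t) then g v else 0#) (p≗q v))

  push-id : ∀ {k} (g : Fin k → Carrier) t → push id g t ≈ g t
  push-id g t = sum-δ′ t g

  push-∘ : ∀ {k l o} (p : Fin l → Fin o) (q : Fin k → Fin l) g t → push p (push q g) t ≈ push (p ∘ q) g t
  push-∘ p q g t = begin
    push p (push q g) t
      ≈⟨ sum-cong-≋ (λ x → if-sum (does (p x ≟ t)) (λ z → if does (q z ≟ x) then g z else 0#)) ⟩
    sum (λ x → sum λ z → if does (p x ≟ t) then (if does (q z ≟ x) then g z else 0#) else 0#)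
      ≈⟨ ∑-comm (λ x z → if does (p x ≟ t) then (if does (q z ≟ x) then g z else 0#) else 0#) ⟩
    sum (λ z → sum λ x → if does (p x ≟ t) then (if does (q z ≟ x) then g z else 0#) else 0#)
      ≈⟨ sum-cong-≋ (λ z → sum-cong-≋ λ x → if-if-comm (does (p x ≟ t)) (does (q z ≟ x)) (g z)) ⟩
    sum (λ z → sum λ x → if does (q z ≟ x) then (if does (p x ≟ t) then g z else 0#) else 0#)
      ≈⟨ sum-cong-≋ (λ z → sum-δ (q z) (λ x → if does (p x ≟ t) then g z else 0#)) ⟩
    push (p ∘ q) g t ∎

  push-sum : ∀ {k l i} (p : Fin k → Fin l) (g : Fin i → Fin k → Carrier) t →
             push p (λ x → sum λ j → g j x) t ≈ sum λ j → push p (g j) t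
  push-sum p g t = trans (sum-cong-≋ λ x → if-sum (does (p x ≟ t)) (λ j → g j x))
                         (∑-comm (λ x j → if does (p x ≟ t) then g j x else 0#))

  push-* : ∀ {k l} (p : Fin k → Fin l) a g t → push p (λ x → a * g x) t ≈ a * push p g t
  push-* p a g t = trans (sum-cong-≋ λ x → sym (*-if (does (p x ≟ t)) a (g x)))
                         (sym (*-distribˡ-sum a (λ x → if does (p x ≟ t) then g x else 0#)))

  push-if : ∀ {k l} (p : Fin k → Fin l) b g t →
            push p (λ x → if b then g x else 0#) t ≈ (if b then push p g t else 0#)
  push-if p b g t = trans (sum-cong-≋ λ x → if-if-comm (does (p x ≟ t)) b (g x))
                          (sym (if-sum b (λ x → if does (p x ≟ t) then g x else 0#)))

  sum-push : ∀ {k l} (p : Fin k → Fin l) g → sum (push p g) ≈ sum g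
  sum-push p g = trans (∑-comm (λ t v → if does (p v ≟ t) then g v else 0#))
                       (sum-cong-≋ λ v → sum-δ (p v) (λ _ → g v))

  sum-push-* : ∀ {k l} (q : Fin k → Fin l) g (h : Fin l → Carrier) →
               sum (λ w → push q g w * h w) ≈ sum (λ v → g v * h (q v))
  sum-push-* q g h = begin
    sum (λ w → push q g w * h w)
      ≈⟨ sum-cong-≋ (λ w → *-distribʳ-sum (h w) (λ v → if does (q v ≟ w) then g v else 0#)) ⟩
    sum (λ w → sum λ v → (if does (q v ≟ w) then g v else 0#) * h w)
      ≈⟨ sum-cong-≋ (λ w → sum-cong-≋ λ v → if-* (does (q v ≟ w)) (g v) (h w)) ⟩
    sum (λ w → sum λ v → if does (q v ≟ w) then g v * h w else 0#)
      ≈⟨ ∑-comm (λ w v → if does (q v ≟ w) then g v * h w else 0#) ⟩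
    sum (λ v → sum λ w → if does (q v ≟ w) then g v * h w else 0#)
      ≈⟨ sum-cong-≋ (λ v → sum-δ (q v) (λ w → g v * h w)) ⟩
    sum (λ v → g v * h (q v)) ∎

module SupportOrder {n : ℕ} (S : LRB n) {m : ℕ} (Sp : Support S m) where
  open LRB S
  open Support Sp
  open Equivalence using (to; from)
  open ≡.≡-Reasoning

  ⪯-trans : ∀ {u v w} → u ⪯ v → v ⪯ w → u ⪯ w
  ⪯-trans {u} {v} {w} u⪯v v⪯w = begin
    w · u       ≡⟨ ≡.cong (_· u) (≡.sym v⪯w) ⟩
    w · v · u   ≡⟨ assoc w v u ⟩
    w · (v · u) ≡⟨ ≡.cong (w ·_) u⪯v ⟩
    w · v       ≡⟨ v⪯w ⟩
    w           ∎

  ≤L⇒⪯ : ∀ {u v} → supp u ≤L supp v → u ⪯ v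
  ≤L⇒⪯ u≤v = u≤v _ _ ≡.refl ≡.refl

  ⪯⇒≤L : ∀ {u v} → u ⪯ v → supp u ≤L supp v
  ⪯⇒≤L {u} {v} u⪯v u′ v′ u′∼u v′∼v =
    ⪯-trans (proj₁ (to (kernel u′ u) u′∼u)) (⪯-trans u⪯v (proj₂ (to (kernel v′ v) v′∼v)))

  ≤L-refl : ∀ X → X ≤L X
  ≤L-refl X u v u∈X v∈X = proj₁ (to (kernel u v) (≡.trans u∈X (≡.sym v∈X)))

  ≤L-trans : ∀ {X Y Z} → X ≤L Y → Y ≤L Z → X ≤L Z
  ≤L-trans {Y = Y} X≤Y Y≤Z u w u∈X w∈Z with y , y∈Y ← surjective Y =
    ⪯-trans (X≤Y u y u∈X y∈Y) (Y≤Z y w y∈Y w∈Z)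

  ≤L-antisym : ∀ {X Y} → X ≤L Y → Y ≤L X → X ≡ Y
  ≤L-antisym {X} {Y} X≤Y Y≤X with x , ≡.refl ← surjective X | y , ≡.refl ← surjective Y =
    from (kernel x y) (≤L⇒⪯ X≤Y , ≤L⇒⪯ Y≤X)

  ≤L-isPartialOrder : IsPartialOrder _≡_ _≤L_
  ≤L-isPartialOrder = record
    { isPreorder = record
      { isEquivalence = ≡.isEquivalence
      ; reflexive     = λ { ≡.refl → ≤L-refl _ }
      ; trans         = ≤L-trans
      }
    ; antisym = ≤L-antisym
    }

  _<L_ : Rel (Fin m) _
  _<L_ = ToStrict._<_ _≡_ _≤L_

  <L-wellFounded : WellFounded _<L_
  <L-wellFounded = po-wellFounded ≤L-isPartialOrder

  supp-one-≤L : ∀ X → supp one ≤L X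
  supp-one-≤L X u v u∼one _ = ⪯-trans (proj₁ (to (kernel u one) u∼one)) (identityʳ v)

  supp-·-upperˡ : ∀ u v → supp u ≤L supp (u · v)
  supp-·-upperˡ u v = ⪯⇒≤L (leftReg u v)

  supp-·-upperʳ : ∀ u v → supp v ≤L supp (u · v)
  supp-·-upperʳ u v = ⪯⇒≤L (≡.trans (assoc u v v) (≡.cong (u ·_) (idem v)))

  supp-·-lub : ∀ {u v Y} → supp u ≤L Y → supp v ≤L Y → supp (u · v) ≤L Y
  supp-·-lub {u} {v} {Y} u≤Y v≤Y with y , y∈Y ← surjective Y =
    ≡.subst (supp (u · v) ≤L_) y∈Y (⪯⇒≤L (begin
      y · (u · v) ≡⟨ ≡.sym (assoc y u v) ⟩
      y · u · v   ≡⟨ ≡.cong (_· v) (u≤Y u y ≡.refl y∈Y) ⟩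
      y · v       ≡⟨ v≤Y v y ≡.refl y∈Y ⟩
      y           ∎))

module SemigroupAlgebraProperties
         {c ℓ : Level} (F : Field c ℓ) {n : ℕ} (S : LRB n) {m : ℕ} (Sp : Support S m) where
  open Field F
  open LRB S using (_·_; one; leftReg)
    renaming (assoc to ·-assoc; identityˡ to ·-identityˡ; identityʳ to ·-identityʳ)
  open Support Sp
  open SupportOrder S Sp
  open SemigroupAlgebra F S Sp
  open ConditionalSums semiring
  open SemiringSum semiring using (sum; sum-cong-≋; ∑-comm; ∑-distrib-+; *-distribˡ-sum; *-distribʳ-sum)
  open SetoidReasoning setoid

  •-via-push : ∀ f g t → (f • g) t ≈ sum λ u → f u * push (u ·_) g t
  •-via-push f g t = sum-cong-≋ λ u → push-* (u ·_) (f u) g t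

  •-cong : ∀ {f f′ g g′} → f ≈ₛ f′ → g ≈ₛ g′ → f • g ≈ₛ f′ • g′
  •-cong f≈f′ g≈g′ t =
    sum-cong-≋ λ u → sum-cong-≋ λ v → if-cong (does (u · v ≟ t)) (*-cong (f≈f′ u) (g≈g′ v))

  •-congˡ : ∀ {f g g′} → g ≈ₛ g′ → f • g ≈ₛ f • g′
  •-congˡ = •-cong (λ _ → refl)

  •-congʳ : ∀ {f f′ g} → f ≈ₛ f′ → f • g ≈ₛ f′ • g
  •-congʳ f≈f′ = •-cong f≈f′ (λ _ → refl)

  δ-• : ∀ u g → δ u • g ≈ₛ push (u ·_) g
  δ-• u g t = begin
    (δ u • g) t                                               ≈⟨ •-via-push (δ u) g t ⟩
    sum (λ w → δ u w * push (w ·_) g t)                       ≈⟨ sum-cong-≋ unit ⟩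
    sum (λ w → if does (u ≟ w) then push (w ·_) g t else 0#) ≈⟨ sum-δ u (λ w → push (w ·_) g t) ⟩
    push (u ·_) g t                                           ∎
    where
    unit : ∀ w → δ u w * push (w ·_) g t ≈ (if does (u ≟ w) then push (w ·_) g t else 0#)
    unit w = trans (if-* (does (u ≟ w)) 1# _) (if-cong (does (u ≟ w)) (*-identityˡ _))

  •-δ : ∀ f s → f • δ s ≈ₛ push (_· s) f
  •-δ f s t = begin
    (f • δ s) t                                              ≈⟨ •-via-push f (δ s) t ⟩
    sum (λ u → f u * push (u ·_) (δ s) t)                   ≈⟨ sum-cong-≋ (λ u → *-congˡ (push-δ u)) ⟩
    sum (λ u → f u * (if does (u · s ≟ t) then 1# else 0#)) ≈⟨ sum-cong-≋ unit ⟩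
    push (_· s) f t                                          ∎
    where
    push-δ : ∀ u → push (u ·_) (δ s) t ≈ (if does (u · s ≟ t) then 1# else 0#)
    push-δ u = trans (sum-cong-≋ λ v → if-if-comm (does (u · v ≟ t)) (does (s ≟ v)) 1#)
                     (sum-δ s (λ v → if does (u · v ≟ t) then 1# else 0#))
    unit : ∀ u → f u * (if does (u · s ≟ t) then 1# else 0#) ≈ (if does (u · s ≟ t) then f u else 0#)
    unit u = trans (*-if (does (u · s ≟ t)) (f u) 1#) (if-cong (does (u · s ≟ t)) (*-identityʳ (f u)))

  •-identityˡ : ∀ g → oneₛ • g ≈ₛ g
  •-identityˡ g t = begin
    (oneₛ • g) t      ≈⟨ δ-• one g t ⟩
    push (one ·_) g t ≈⟨ push-congˡ g t ·-identityˡ ⟩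
    push id g t       ≈⟨ push-id g t ⟩
    g t               ∎

  •-identityʳ : ∀ f → f • oneₛ ≈ₛ f
  •-identityʳ f t = begin
    (f • oneₛ) t      ≈⟨ •-δ f one t ⟩
    push (_· one) f t ≈⟨ push-congˡ f t ·-identityʳ ⟩
    push id f t       ≈⟨ push-id f t ⟩
    f t               ∎

  push-• : ∀ u g h t → push (u ·_) (g • h) t ≈ sum λ v → g v * push ((u · v) ·_) h t
  push-• u g h t = begin
    push (u ·_) (g • h) t
      ≈⟨ push-cong (u ·_) t (•-via-push g h) ⟩
    push (u ·_) (λ x → sum λ v → g v * push (v ·_) h x) t
      ≈⟨ push-sum (u ·_) (λ v x → g v * push (v ·_) h x) t ⟩
    sum (λ v → push (u ·_) (λ x → g v * push (v ·_) h x) t)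
      ≈⟨ sum-cong-≋ (λ v → push-* (u ·_) (g v) (push (v ·_) h) t) ⟩
    sum (λ v → g v * push (u ·_) (push (v ·_) h) t)
      ≈⟨ sum-cong-≋ (λ v → *-congˡ (reassociate v)) ⟩
    sum (λ v → g v * push ((u · v) ·_) h t) ∎
    where
    reassociate : ∀ v → push (u ·_) (push (v ·_) h) t ≈ push ((u · v) ·_) h t
    reassociate v = trans (push-∘ (u ·_) (v ·_) h t) (push-congˡ h t λ w → ≡.sym (·-assoc u v w))

  •-assoc : ∀ f g h → (f • g) • h ≈ₛ f • (g • h)
  •-assoc f g h t = begin
    ((f • g) • h) t
      ≈⟨ •-via-push (f • g) h t ⟩
    sum (λ w → (f • g) w * push (w ·_) h t)
      ≈⟨ sum-cong-≋ (λ w → *-congʳ (•-via-push f g w)) ⟩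
    sum (λ w → sum (λ u → f u * push (u ·_) g w) * push (w ·_) h t)
      ≈⟨ sum-*-swap f (λ u → push (u ·_) g) (λ w → push (w ·_) h t) ⟩
    sum (λ u → f u * sum (λ w → push (u ·_) g w * push (w ·_) h t))
      ≈⟨ sum-cong-≋ (λ u → *-congˡ (sum-push-* (u ·_) g (λ w → push (w ·_) h t))) ⟩
    sum (λ u → f u * sum (λ v → g v * push ((u · v) ·_) h t))
      ≈⟨ sum-cong-≋ (λ u → *-congˡ (sym (push-• u g h t))) ⟩
    sum (λ u → f u * push (u ·_) (g • h) t)
      ≈⟨ sym (•-via-push f (g • h) t) ⟩
    (f • (g • h)) t ∎

  •-distribʳ : ∀ f g h → (f +ₛ g) • h ≈ₛ f • h +ₛ g • h
  •-distribʳ f g h t = begin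
    ((f +ₛ g) • h) t
      ≈⟨ •-via-push (f +ₛ g) h t ⟩
    sum (λ u → (f u + g u) * push (u ·_) h t)
      ≈⟨ sum-cong-≋ (λ u → distribʳ _ (f u) (g u)) ⟩
    sum (λ u → f u * push (u ·_) h t + g u * push (u ·_) h t)
      ≈⟨ ∑-distrib-+ (λ u → f u * push (u ·_) h t) (λ u → g u * push (u ·_) h t) ⟩
    sum (λ u → f u * push (u ·_) h t) + sum (λ u → g u * push (u ·_) h t)
      ≈⟨ +-cong (sym (•-via-push f h t)) (sym (•-via-push g h t)) ⟩
    (f • h +ₛ g • h) t ∎

  ⋆-• : ∀ a f h → (a ⋆ f) • h ≈ₛ a ⋆ (f • h)
  ⋆-• a f h t = begin
    ((a ⋆ f) • h) t                          ≈⟨ •-via-push (a ⋆ f) h t ⟩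
    sum (λ u → (a * f u) * push (u ·_) h t) ≈⟨ sum-cong-≋ (λ u → *-assoc a (f u) _) ⟩
    sum (λ u → a * (f u * push (u ·_) h t)) ≈⟨ sym (*-distribˡ-sum a (λ u → f u * push (u ·_) h t)) ⟩
    a * sum (λ u → f u * push (u ·_) h t)   ≈⟨ *-congˡ (sym (•-via-push f h t)) ⟩
    (a ⋆ (f • h)) t                          ∎

  sum-• : ∀ f g → sum (f • g) ≈ sum f * sum g
  sum-• f g = begin
    sum (f • g)
      ≈⟨ sum-cong-≋ (•-via-push f g) ⟩
    sum (λ t → sum λ u → f u * push (u ·_) g t)
      ≈⟨ ∑-comm (λ t u → f u * push (u ·_) g t) ⟩
    sum (λ u → sum λ t → f u * push (u ·_) g t)
      ≈⟨ sum-cong-≋ (λ u → sym (*-distribˡ-sum (f u) (push (u ·_) g))) ⟩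
    sum (λ u → f u * sum (push (u ·_) g))
      ≈⟨ sum-cong-≋ (λ u → *-congˡ (sum-push (u ·_) g)) ⟩
    sum (λ u → f u * sum g)
      ≈⟨ sym (*-distribʳ-sum (sum g) f) ⟩
    sum f * sum g ∎

  δ-•-δ : ∀ s a → (δ s • a) • δ s ≈ₛ δ s • a
  δ-•-δ s a t = begin
    ((δ s • a) • δ s) t           ≈⟨ •-δ (δ s • a) s t ⟩
    push (_· s) (δ s • a) t       ≈⟨ push-cong (_· s) t (δ-• s a) ⟩
    push (_· s) (push (s ·_) a) t ≈⟨ push-∘ (_· s) (s ·_) a t ⟩
    push (λ v → s · v · s) a t    ≈⟨ push-congˡ a t (leftReg s) ⟩
    push (s ·_) a t               ≈⟨ sym (δ-• s a t) ⟩
    (δ s • a) t                   ∎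

  δ-•-idempotent : ∀ s {a} → IsIdempotent a → IsIdempotent (δ s • a)
  δ-•-idempotent s {a} a-idem t = begin
    ((δ s • a) • (δ s • a)) t ≈⟨ sym (•-assoc (δ s • a) (δ s) a t) ⟩
    (((δ s • a) • δ s) • a) t ≈⟨ •-congʳ (δ-•-δ s a) t ⟩
    ((δ s • a) • a) t         ≈⟨ •-assoc (δ s) a a t ⟩
    (δ s • (a • a)) t         ≈⟨ •-congˡ a-idem t ⟩
    (δ s • a) t               ∎

  proj-cong : ∀ Y {f g} → f ≈ₛ g → proj Y f ≈ₛ proj Y g
  proj-cong Y f≈g s = if-cong (does (supp s ≤L? Y)) (f≈g s)

  proj-inside : ∀ {Y} f {s} → supp s ≤L Y → proj Y f s ≈ f s
  proj-inside {Y} f {s} = if-yes (supp s ≤L? Y)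

  proj-InSub : ∀ Y f → InSub Y (proj Y f)
  proj-InSub Y f s = if-no (supp s ≤L? Y)

  proj-id : ∀ {Y f} → InSub Y f → proj Y f ≈ₛ f
  proj-id {Y} {f} f∈ s with supp s ≤L? Y
  ... | yes s≤Y = proj-inside f s≤Y
  ... | no s≰Y = trans (proj-InSub Y f s s≰Y) (sym (f∈ s s≰Y))

  proj-zero : ∀ Y → proj Y zeroₛ ≈ₛ zeroₛ
  proj-zero Y s = if-≈0 (does (supp s ≤L? Y)) refl

  proj-one : ∀ Y → proj Y oneₛ ≈ₛ oneₛ
  proj-one Y s with supp s ≤L? Y
  ... | yes s≤Y = proj-inside oneₛ s≤Y
  ... | no s≰Y =
    trans (proj-InSub Y oneₛ s s≰Y) (sym (if-no (one ≟ s) λ { ≡.refl → s≰Y (supp-one-≤L Y) }))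

  proj-• : ∀ Y f g → proj Y (f • g) ≈ₛ proj Y f • proj Y g
  proj-• Y f g t with supp t ≤L? Y
  ... | yes t≤Y =
    trans (proj-inside (f • g) t≤Y) (sum-cong-≋ λ u → sum-cong-≋ λ v → inside t≤Y u v (u · v ≟ t))
    where
    inside : ∀ {t} → supp t ≤L Y → ∀ u v (d : Dec (u · v ≡ t)) →
             (if does d then f u * g v else 0#) ≈ (if does d then proj Y f u * proj Y g v else 0#)
    inside t≤Y u v (yes ≡.refl) =
      sym (*-cong (proj-inside f (≤L-trans (supp-·-upperˡ u v) t≤Y))
                  (proj-inside g (≤L-trans (supp-·-upperʳ u v) t≤Y)))
    inside t≤Y u v (no _) = refl
  ... | no t≰Y =
    trans (proj-InSub Y (f • g) t t≰Y) (sym (sum-≈0 λ u → sum-≈0 λ v → outside t≰Y u v (u · v ≟ t)))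
    where
    outside : ∀ {t} → ¬ supp t ≤L Y → ∀ u v (d : Dec (u · v ≡ t)) →
              (if does d then proj Y f u * proj Y g v else 0#) ≈ 0#
    outside t≰Y u v (no _) = refl
    outside t≰Y u v (yes ≡.refl) with supp u ≤L? Y | supp v ≤L? Y
    ... | yes u≤Y | yes v≤Y = contradiction (supp-·-lub u≤Y v≤Y) t≰Y
    ... | no u≰Y  | _       = trans (*-congʳ (proj-InSub Y f u u≰Y)) (zeroˡ _)
    ... | yes _   | no v≰Y  = trans (*-congˡ (proj-InSub Y g v v≰Y)) (zeroʳ _)

  proj-idempotent : ∀ Y {a} → IsIdempotent a → IsIdempotent (proj Y a)
  proj-idempotent Y {a} a-idem t = trans (sym (proj-• Y a a t)) (proj-cong Y a-idem t)

  proj-proj : ∀ {Z Y} f → Z ≤L Y → proj Z (proj Y f) ≈ₛ proj Z f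
  proj-proj {Z} {Y} f Z≤Y s with supp s ≤L? Z
  ... | yes s≤Z = begin
    proj Z (proj Y f) s ≈⟨ proj-inside (proj Y f) s≤Z ⟩
    proj Y f s          ≈⟨ proj-inside f (≤L-trans s≤Z Z≤Y) ⟩
    f s                 ≈⟨ sym (proj-inside f s≤Z) ⟩
    proj Z f s          ∎
  ... | no s≰Z = trans (proj-InSub Z (proj Y f) s s≰Z) (sym (proj-InSub Z f s s≰Z))

  proj-sumOver : ∀ Y {p} {P : Fin p → Set} (P? : ∀ i → Dec (P i)) f →
                 proj Y (sumOver P? f) ≈ₛ sumOver P? (λ i → proj Y (f i))
  proj-sumOver Y P? f s = trans (if-sum (does (supp s ≤L? Y)) (λ i → if does (P? i) then f i s else 0#))
                                (sum-cong-≋ λ i → if-if-comm (does (supp s ≤L? Y)) (does (P? i)) (f i s))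

  -- χ X f is, by definition, the sum of the coefficients of proj X f.

  χ-cong : ∀ X {f g} → f ≈ₛ g → χ X f ≈ χ X g
  χ-cong X f≈g = sum-cong-≋ (proj-cong X f≈g)

  χ-zero : ∀ X → χ X zeroₛ ≈ 0#
  χ-zero X = sum-≈0 (proj-zero X)

  χ-+ : ∀ X f g → χ X (f +ₛ g) ≈ χ X f + χ X g
  χ-+ X f g = trans (sum-cong-≋ λ s → if-+ (does (supp s ≤L? X)) (f s) (g s))
                    (∑-distrib-+ (proj X f) (proj X g))

  χ-• : ∀ X f g → χ X (f • g) ≈ χ X f * χ X g
  χ-• X f g = trans (sum-cong-≋ (proj-• X f g)) (sum-• (proj X f) (proj X g))

  χ-proj : ∀ {Z Y} f → Z ≤L Y → χ Z (proj Y f) ≈ χ Z f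
  χ-proj f Z≤Y = sum-cong-≋ (proj-proj f Z≤Y)

  χ-δ≈0 : ∀ {s X} → ¬ supp s ≤L X → χ X (δ s) ≈ 0#
  χ-δ≈0 {s} {X} s≰X = sum-≈0 proj-δ≈0
    where
    proj-δ≈0 : ∀ t → proj X (δ s) t ≈ 0#
    proj-δ≈0 t with supp t ≤L? X
    ... | yes t≤X = trans (proj-inside (δ s) t≤X) (if-no (s ≟ t) λ { ≡.refl → s≰X t≤X })
    ... | no t≰X = proj-InSub X (δ s) t t≰X

  χ-orthogonal : ∀ X {f g} → f • g ≈ₛ zeroₛ → χ X f * χ X g ≈ 0#
  χ-orthogonal X {f} {g} fg≈0 = trans (sym (χ-• X f g)) (trans (χ-cong X fg≈0) (χ-zero X))

  χ-idempotent : ∀ X {a} → IsIdempotent a → χ X a * χ X a ≈ χ X a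
  χ-idempotent X {a} a-idem = trans (sym (χ-• X a a)) (χ-cong X a-idem)

  module _ {a : KS} (a-idem : IsIdempotent a) where

    proj-supp≈proj-supp*χ : ∀ s → (∀ {t} → supp t <L supp s → a t ≈ 0#) →
                            proj (supp s) a s ≈ proj (supp s) a s * χ (supp s) a
    proj-supp≈proj-supp*χ s below≈0 = begin
      g s
        ≈⟨ sym (proj-idempotent Z a-idem s) ⟩
      (g • g) s
        ≈⟨ sum-cong-≋ (λ u → sum-cong-≋ λ v → collapse u v) ⟩
      sum (λ u → sum λ v → if does (u ≟ s) then g u * g v else 0#)
        ≈⟨ sum-cong-≋ (λ u → sym (if-sum (does (u ≟ s)) (λ v → g u * g v))) ⟩
      sum (λ u → if does (u ≟ s) then sum (λ v → g u * g v) else 0#)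
        ≈⟨ sum-δ′ s (λ u → sum (λ v → g u * g v)) ⟩
      sum (λ v → g s * g v)
        ≈⟨ sym (*-distribˡ-sum (g s) g) ⟩
      g s * χ Z a ∎
      where
      Z : Fin m
      Z = supp s
      g : KS
      g = proj Z a
      survivors : ∀ u v → (g u * g v ≈ 0#) ⊎ (u · v ≡ u)
      survivors u v with supp u ≤L? Z | supp u ≟ Z | supp v ≤L? Z
      ... | no u≰Z  | _       | _       = inj₁ (trans (*-congʳ (proj-InSub Z a u u≰Z)) (zeroˡ _))
      ... | yes u≤Z | no u≢Z  | _       =
        inj₁ (trans (*-congʳ (trans (proj-inside a u≤Z) (below≈0 (u≤Z , u≢Z)))) (zeroˡ _))
      ... | yes _   | yes _   | no v≰Z  = inj₁ (trans (*-congˡ (proj-InSub Z a v v≰Z)) (zeroʳ _))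
      ... | yes _   | yes u≡Z | yes v≤Z = inj₂ (≤L⇒⪯ (≡.subst (supp v ≤L_) (≡.sym u≡Z) v≤Z))
      collapse : ∀ u v →
                 (if does (u · v ≟ s) then g u * g v else 0#) ≈ (if does (u ≟ s) then g u * g v else 0#)
      collapse u v with survivors u v
      ... | inj₁ guv≈0 = trans (if-≈0 (does (u · v ≟ s)) guv≈0) (sym (if-≈0 (does (u ≟ s)) guv≈0))
      ... | inj₂ uv≡u = reflexive (≡.cong (λ w → if does (w ≟ s) then g u * g v else 0#) uv≡u)

    idempotent-vanishes : (∀ s → a s ≈ 0# ⊎ χ (supp s) a ≈ 0#) → a ≈ₛ zeroₛ
    idempotent-vanishes vanishes = All.wfRec (On.wellFounded supp <L-wellFounded) ℓ (λ s → a s ≈ 0#) step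
      where
      step : ∀ s → (∀ {t} → supp t <L supp s → a t ≈ 0#) → a s ≈ 0#
      step s below≈0 with vanishes s
      ... | inj₁ as≈0 = as≈0
      ... | inj₂ χa≈0 = begin
        a s                               ≈⟨ sym (proj-inside a (≤L-refl (supp s))) ⟩
        proj (supp s) a s                 ≈⟨ proj-supp≈proj-supp*χ s below≈0 ⟩
        proj (supp s) a s * χ (supp s) a ≈⟨ *-congˡ χa≈0 ⟩
        proj (supp s) a s * 0#            ≈⟨ zeroʳ _ ⟩
        0#                                ∎

  idempotent-in-sub-vanishes : ∀ {Y a} → InSub Y a → IsIdempotent a →
                               (∀ Z → Z ≤L Y → χ Z a ≈ 0#) → a ≈ₛ zeroₛ
  idempotent-in-sub-vanishes {Y} {a} a∈ a-idem χ≈0 = idempotent-vanishes a-idem vanishes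
    where
    vanishes : ∀ s → a s ≈ 0# ⊎ χ (supp s) a ≈ 0#
    vanishes s with supp s ≤L? Y
    ... | yes s≤Y = inj₂ (χ≈0 (supp s) s≤Y)
    ... | no s≰Y = inj₁ (a∈ s s≰Y)

  module ProjectedSystem (Y : Fin m) (e : Fin m → KS)
           (e-complete : IsCompleteSystem Whole everyIndex e) (χe≈1 : ∀ X → χ X (e X) ≈ 1#) where

    e-idempotent : ∀ X → IsIdempotent (e X)
    e-idempotent X = proj₁ (proj₂ (proj₁ e-complete X _))

    e-orthogonal : ∀ {X Z} → X ≢ Z → e X • e Z ≈ₛ zeroₛ
    e-orthogonal X≢Z = proj₁ (proj₂ e-complete) _ _ _ _ X≢Z

    χ-e≈0 : ∀ {X Z} → X ≢ Z → χ X (e Z) ≈ 0#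
    χ-e≈0 {X} {Z} X≢Z = begin
      χ X (e Z)             ≈⟨ sym (*-identityˡ _) ⟩
      1# * χ X (e Z)        ≈⟨ *-congʳ (sym (χe≈1 X)) ⟩
      χ X (e X) * χ X (e Z) ≈⟨ χ-orthogonal X (e-orthogonal X≢Z) ⟩
      0#                    ∎

    δ-•-e≈0 : ∀ {s X} → ¬ supp s ≤L X → δ s • e X ≈ₛ zeroₛ
    δ-•-e≈0 {s} {X} s≰X =
      idempotent-vanishes (δ-•-idempotent s (e-idempotent X)) λ t → inj₂ (χ≈0 (supp t))
      where
      χ≈0 : ∀ Z → χ Z (δ s • e X) ≈ 0#
      χ≈0 Z with Z ≟ X
      ... | yes ≡.refl = trans (χ-• Z (δ s) (e X)) (trans (*-congʳ (χ-δ≈0 s≰X)) (zeroˡ _))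
      ... | no Z≢X = trans (χ-• Z (δ s) (e X)) (trans (*-congˡ (χ-e≈0 Z≢X)) (zeroʳ _))

    proj-e-idempotent : ∀ X → IsIdempotent (proj Y (e X))
    proj-e-idempotent X = proj-idempotent Y (e-idempotent X)

    proj-e≈0 : ∀ {X} → ¬ X ≤L Y → proj Y (e X) ≈ₛ zeroₛ
    proj-e≈0 {X} X≰Y = idempotent-in-sub-vanishes (proj-InSub Y (e X)) (proj-e-idempotent X)
      λ Z Z≤Y → trans (χ-proj (e X) Z≤Y) (χ-e≈0 λ { ≡.refl → X≰Y Z≤Y })

    proj-e-sum : sumOver (_≤L? Y) (λ X → proj Y (e X)) ≈ₛ oneₛ
    proj-e-sum s = begin
      sumOver (_≤L? Y) (λ X → proj Y (e X)) s  ≈⟨ sum-cong-≋ restrict ⟩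
      sumOver everyIndex (λ X → proj Y (e X)) s ≈⟨ sym (proj-sumOver Y everyIndex e s) ⟩
      proj Y (sumOver everyIndex e) s           ≈⟨ proj-cong Y (proj₂ (proj₂ e-complete)) s ⟩
      proj Y oneₛ s                             ≈⟨ proj-one Y s ⟩
      oneₛ s                                    ∎
      where
      restrict : ∀ X → (if does (X ≤L? Y) then proj Y (e X) s else 0#) ≈ proj Y (e X) s
      restrict X with X ≤L? Y
      ... | yes X≤Y = if-yes (X ≤L? Y) X≤Y
      ... | no X≰Y = trans (if-no (X ≤L? Y) X≰Y) (sym (proj-e≈0 X≰Y s))

    proj-e-orthogonal : ∀ {X Z} → X ≢ Z → proj Y (e X) • proj Y (e Z) ≈ₛ zeroₛ
    proj-e-orthogonal {X} {Z} X≢Z t =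
      trans (sym (proj-• Y (e X) (e Z) t)) (trans (proj-cong Y (e-orthogonal X≢Z) t) (proj-zero Y t))

    summand-vanishes : ∀ {X a b} → InSub Y a → IsIdempotent a → a • b ≈ₛ zeroₛ →
                       proj Y (e X) ≈ₛ a +ₛ b → χ X a ≈ 0# → a ≈ₛ zeroₛ
    summand-vanishes {X} {a} {b} a∈ a-idem ab≈0 eX≈a+b χXa≈0 = idempotent-in-sub-vanishes a∈ a-idem χ≈0
      where
      χ≈0 : ∀ Z → Z ≤L Y → χ Z a ≈ 0#
      χ≈0 Z Z≤Y with Z ≟ X
      ... | yes ≡.refl = χXa≈0
      ... | no Z≢X = idempotent≈0 semiring (χ-idempotent Z a-idem) (χ-orthogonal Z ab≈0) (begin
        χ Z a + χ Z b      ≈⟨ sym (χ-+ Z a b) ⟩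
        χ Z (a +ₛ b)       ≈⟨ sym (χ-cong Z eX≈a+b) ⟩
        χ Z (proj Y (e X)) ≈⟨ χ-proj (e X) Z≤Y ⟩
        χ Z (e X)          ≈⟨ χ-e≈0 Z≢X ⟩
        0#                 ∎)

    proj-e-primitive : ∀ {X} → X ≤L Y → IsPrimitiveIn (InSub Y) (proj Y (e X))
    proj-e-primitive {X} X≤Y = proj-InSub Y (e X) , proj-e-idempotent X , nonzero , indecomposable
      where
      nonzero : ¬ proj Y (e X) ≈ₛ zeroₛ
      nonzero eX≈0 = 0≉1 (begin
        0#                 ≈⟨ sym (χ-zero X) ⟩
        χ X zeroₛ          ≈⟨ sym (χ-cong X eX≈0) ⟩
        χ X (proj Y (e X)) ≈⟨ χ-proj (e X) X≤Y ⟩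
        χ X (e X)          ≈⟨ χe≈1 X ⟩
        1#                 ∎)
      indecomposable : ∀ a b → InSub Y a → InSub Y b → IsIdempotent a → IsIdempotent b → Orthogonal a b →
                       proj Y (e X) ≈ₛ a +ₛ b → ¬ a ≈ₛ zeroₛ → ¬ b ≈ₛ zeroₛ → ⊥
      indecomposable a b a∈ b∈ a-idem b-idem (ab≈0 , ba≈0) eX≈a+b a≉0 b≉0 =
        b≉0 (summand-vanishes b∈ b-idem ba≈0 eX≈b+a
              (x≉0⇒x*y≈0⇒y≈0 F χXa≉0 (χ-orthogonal X ab≈0)))
        where
        eX≈b+a : proj Y (e X) ≈ₛ b +ₛ a
        eX≈b+a s = trans (eX≈a+b s) (+-comm (a s) (b s))
        χXa≉0 : ¬ χ X a ≈ 0#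
        χXa≉0 χXa≈0 = a≉0 (summand-vanishes a∈ a-idem ab≈0 eX≈a+b χXa≈0)

    proj-e-isCompleteSystem : IsCompleteSystem (InSub Y) (_≤L? Y) (λ X → proj Y (e X))
    proj-e-isCompleteSystem = (λ _ X≤Y → proj-e-primitive X≤Y) , (λ _ _ _ _ → proj-e-orthogonal) , proj-e-sum

    ε : KS
    ε = sumOver (_≤L? Y) e

    push-ε≈0 : ∀ {u} t → ¬ supp u ≤L Y → push (u ·_) ε t ≈ 0#
    push-ε≈0 {u} t u≰Y = begin
      push (u ·_) ε t
        ≈⟨ push-sum (u ·_) (λ X x → if does (X ≤L? Y) then e X x else 0#) t ⟩
      sum (λ X → push (u ·_) (λ x → if does (X ≤L? Y) then e X x else 0#) t)
        ≈⟨ sum-cong-≋ (λ X → push-if (u ·_) (does (X ≤L? Y)) (e X) t) ⟩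
      sum (λ X → if does (X ≤L? Y) then push (u ·_) (e X) t else 0#)
        ≈⟨ sum-≈0 term ⟩
      0# ∎
      where
      term : ∀ X → (if does (X ≤L? Y) then push (u ·_) (e X) t else 0#) ≈ 0#
      term X with X ≤L? Y
      ... | yes X≤Y = begin
        (if does (X ≤L? Y) then push (u ·_) (e X) t else 0#) ≈⟨ if-yes (X ≤L? Y) X≤Y ⟩
        push (u ·_) (e X) t                                  ≈⟨ sym (δ-• u (e X) t) ⟩
        (δ u • e X) t                                        ≈⟨ δ-•-e≈0 u≰X t ⟩
        0#                                                   ∎
        where
        u≰X : ¬ supp u ≤L X
        u≰X u≤X = u≰Y (≤L-trans u≤X X≤Y)
      ... | no X≰Y = if-no (X ≤L? Y) X≰Y

    proj[b]•ε≈b•ε : ∀ b → proj Y b • ε ≈ₛ b • ε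
    proj[b]•ε≈b•ε b t = begin
      (proj Y b • ε) t                          ≈⟨ •-via-push (proj Y b) ε t ⟩
      sum (λ u → proj Y b u * push (u ·_) ε t) ≈⟨ sum-cong-≋ term ⟩
      sum (λ u → b u * push (u ·_) ε t)        ≈⟨ sym (•-via-push b ε t) ⟩
      (b • ε) t                                 ∎
      where
      term : ∀ u → proj Y b u * push (u ·_) ε t ≈ b u * push (u ·_) ε t
      term u with supp u ≤L? Y
      ... | yes u≤Y = *-congʳ (proj-inside b u≤Y)
      ... | no u≰Y = begin
        proj Y b u * push (u ·_) ε t ≈⟨ *-congˡ (push-ε≈0 t u≰Y) ⟩
        proj Y b u * 0#              ≈⟨ zeroʳ _ ⟩
        0#                           ≈⟨ sym (zeroʳ _) ⟩
        b u * 0#                     ≈⟨ sym (*-congˡ (push-ε≈0 t u≰Y)) ⟩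
        b u * push (u ·_) ε t        ∎

    proj-ε : proj Y ε ≈ₛ oneₛ
    proj-ε s = trans (proj-sumOver Y (_≤L? Y) e s) (proj-e-sum s)

    proj[ε•g]≈g : ∀ {g} → InSub Y g → proj Y (ε • g) ≈ₛ g
    proj[ε•g]≈g {g} g∈ s = begin
      proj Y (ε • g) s        ≈⟨ proj-• Y ε g s ⟩
      (proj Y ε • proj Y g) s ≈⟨ •-cong proj-ε (proj-id g∈) s ⟩
      (oneₛ • g) s            ≈⟨ •-identityˡ g s ⟩
      g s                     ∎

    proj[f•ε]≈f : ∀ {f} → InSub Y f → proj Y (f • ε) ≈ₛ f
    proj[f•ε]≈f {f} f∈ s = begin
      proj Y (f • ε) s        ≈⟨ proj-• Y f ε s ⟩
      (proj Y f • proj Y ε) s ≈⟨ •-cong (proj-id f∈) proj-ε s ⟩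
      (f • oneₛ) s            ≈⟨ •-identityʳ f s ⟩
      f s                     ∎

    •ε-homomorphic : ∀ f {g} → InSub Y g → (f • g) • ε ≈ₛ (f • ε) • (g • ε)
    •ε-homomorphic f {g} g∈ t = begin
      ((f • g) • ε) t         ≈⟨ •-assoc f g ε t ⟩
      (f • (g • ε)) t         ≈⟨ •-congˡ gε≈εgε t ⟩
      (f • ((ε • g) • ε)) t   ≈⟨ •-congˡ (•-assoc ε g ε) t ⟩
      (f • (ε • (g • ε))) t   ≈⟨ sym (•-assoc f ε (g • ε) t) ⟩
      ((f • ε) • (g • ε)) t   ∎
      where
      gε≈εgε : g • ε ≈ₛ (ε • g) • ε
      gε≈εgε s = trans (sym (•-congʳ (proj[ε•g]≈g g∈) s)) (proj[b]•ε≈b•ε (ε • g) s)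

    •ε-isAlgIsoOnto : IsAlgIsoOnto Y ε (_• ε)
    •ε-isAlgIsoOnto =
        (λ _ _ _ _ f≈g → •-congʳ f≈g)
      , (λ f g _ _ → •-distribʳ f g ε)
      , (λ a f _ → ⋆-• a f ε)
      , (λ f _ _ g∈ → •ε-homomorphic f g∈)
      , (λ f _ → f , λ _ → refl)
      , (λ f g f∈ g∈ fε≈gε s →
           trans (sym (proj[f•ε]≈f f∈ s)) (trans (proj-cong Y fε≈gε s) (proj[f•ε]≈f g∈ s)))
      , λ { x (a , x≈aε) →
            proj Y a , proj-InSub Y a , λ s → trans (proj[b]•ε≈b•ε a s) (sym (x≈aε s)) }

proposition10p2 : ∀ {c ℓ : Level} (F : Field c ℓ) {n : ℕ} (S : LRB n) {m : ℕ}
    (Sp : Support S m) (Y : Fin m) (e : Fin m → SemigroupAlgebra.KS F S Sp) →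
    SemigroupAlgebra.IsCompleteSystem F S Sp (SemigroupAlgebra.Whole F S Sp) (SemigroupAlgebra.everyIndex F S Sp) e →
    (∀ X → Field._≈_ F (SemigroupAlgebra.χ F S Sp X (e X)) (Field.1# F)) →
    SemigroupAlgebra.IsCompleteSystem F S Sp (SemigroupAlgebra.InSub F S Sp Y) (λ X → Support._≤L?_ Sp X Y) (λ X → SemigroupAlgebra.proj F S Sp Y (e X))
    × ∃ λ φ → SemigroupAlgebra.IsAlgIsoOnto F S Sp Y (SemigroupAlgebra.sumOver F S Sp (λ X → Support._≤L?_ Sp X Y) e) φ
proposition10p2 F S Sp Y e e-complete χe≈1 = proj-e-isCompleteSystem , (_• ε) , •ε-isAlgIsoOnto
  where
  open SemigroupAlgebra F S Sp using (_•_)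
  open SemigroupAlgebraProperties F S Sp using (module ProjectedSystem)
  open ProjectedSystem Y e e-complete χe≈1
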